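{- Let $f:\mathbb{N}\to\mathbb{N}$ be a surjective function with $f(1)=1$, $2\leq f(n)\leq n$ for all $n\geq 2$, and $|f^{ -1}(n)|=\infty$ for all $n\geq 2$, and let $X_n$, $Y_n$, $Y$ be as defined in the context. For every $n\in\mathbb{N}$, every subgraph of $X_n$ admits a coarse $1$-wiring into $Y$ with volume at most $|Y_n|=\big(2^{2^{2n+1}}f(n)+1\big)f(n)$.
   Context: For $n\in\mathbb{N}$, $X_n$ is the graph with vertex set $\{0,1,\dots,f(n)-1\}\times\{0,1,\dots,2^{2^{2n}}f(n)\}$, with an edge between $(i,j)$ and $(i,j+1)$ for all $i$ and all $0\le j\le 2^{2^{2n}}f(n)-1$, and an edge between $(i,j)$ and $(i+1,j)$ whenever $0\le i\le f(n)-2$ and $j=2^{2^{2n}}m$ for some integer $m\geq 0$. $Y_n$ is defined identically with $2^{2^{2n}}$ replaced by $2^{2^{2n+1}}$ throughout: vertex set $\{0,\dots,f(n)-1\}\times\{0,\dots,2^{2^{2n+1}}f(n)\}$, all vertical edges $(i,j)(i,j+1)$, and horizontal edges $(i,j)(i+1,j)$ for $j$ a nonnegative integer multiple of $2^{2^{2n+1}}$. $Y$ is the disjoint union of the $Y_n$, $n\ge1$. A wiring of a finite graph $\Gamma$ into a graph $Y$ is a continuous map $g:\Gamma\to Y$ mapping vertices to vertices and edges to unions of edges; the image of each edge $e$ is a path $P_e$ in $Y$ (possibly a single vertex) joining the images of its endpoints. It is a coarse $k$-wiring if each vertex of $Y$ has at most $k$ preimages among vertices of $\Gamma$ and each edge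 of $Y$ lies in at most $k$ of the paths $P_e$. Its volume is the number of vertices in its image. -}

module Defs where

open import Data.Nat using (ℕ; zero; suc; _+_; _*_; _^_; _≤_; _<_)
open import Data.Nat.Divisibility using (_∣_)
open import Data.Fin using (Fin)
open import Data.Product using (_×_; _,_; Σ; ∃)
open import Data.Sum using (_⊎_)
open import Data.List using (List; []; _∷_; length)
open import Data.List.Relation.Unary.All using (All)
open import Data.List.Relation.Unary.Unique.Propositional using (Unique)
open import Data.List.Membership.Propositional using (_∈_)
open import Relation.Binary.PropositionalEquality using (_≡_)

-- Hypotheses on f  (ℕ = {1,2,3,...}; values of f at 0 are irrelevant)

Surj : (ℕ → ℕ) → Set
Surj f = ∀ m → 1 ≤ m → ∃ λ n → 1 ≤ n × f n ≡ m

InfinitePreimage : (ℕ → ℕ) → ℕ → Set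
InfinitePreimage f m = ∀ N → ∃ λ k → N ≤ k × f k ≡ m

Pt : Set
Pt = ℕ × ℕ

LVert : ℕ → ℕ → Pt → Set
LVert w h (i , j) = i < w × j ≤ h

data LStep (w h s : ℕ) : Pt → Pt → Set where
  vstep : ∀ {i j} → i < w → suc j ≤ h → LStep w h s (i , j) (i , suc j)
  hstep : ∀ {i j} → suc i < w → j ≤ h → s ∣ j → LStep w h s (i , j) (suc i , j)

LAdj : ℕ → ℕ → ℕ → Pt → Pt → Set
LAdj w h s u v = LStep w h s u v ⊎ LStep w h s v u

xS : ℕ → ℕ
xS n = 2 ^ (2 ^ (2 * n))

yS : ℕ → ℕ
yS n = 2 ^ (2 ^ (2 * n + 1))

-- X_n = ladder of width f n, height xS n * f n, rungs at multiples of xS n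
-- Y_n = ladder of width f n, height yS n * f n, rungs at multiples of yS n

-- Y = disjoint union of Y_m, m ≥ 1 : vertices (m , (i , j))
YV : Set
YV = ℕ × Pt

InY : (ℕ → ℕ) → YV → Set
InY f (m , p) = 1 ≤ m × LVert (f m) (yS m * f m) p

YAdj : (ℕ → ℕ) → YV → YV → Set
YAdj f (m , p) (m' , q) = m ≡ m' × 1 ≤ m × LAdj (f m) (yS m * f m) (yS m) p q

record Subgraph (w h s : ℕ) : Set where
  field
    nv      : ℕ
    vert    : Fin nv → Pt
    vert-ok : ∀ a → LVert w h (vert a)
    vert-inj : ∀ a b → vert a ≡ vert b → a ≡ b
    ne      : ℕ
    src tgt : Fin ne → Fin nv
    edge-ok : ∀ e → LAdj w h s (vert (src e)) (vert (tgt e))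
    edge-inj : ∀ e e' →
      (src e ≡ src e' × tgt e ≡ tgt e') ⊎ (src e ≡ tgt e' × tgt e ≡ src e') →
      e ≡ e'

data Chain {A : Set} (R : A → A → Set) : A → List A → A → Set where
  done : ∀ {x} → Chain R x [] x
  step : ∀ {x y ys z} → R x y → Chain R y ys z → Chain R x (y ∷ ys) z

data IsPath {A : Set} (R : A → A → Set) (a b : A) : List A → Set where
  path : ∀ {xs} → Chain R a xs b → Unique (a ∷ xs) → IsPath R a b (a ∷ xs)

data EdgeOn {A : Set} (a b : A) : List A → Set where
  here  : ∀ {xs} → EdgeOn a b (a ∷ b ∷ xs)
  here' : ∀ {xs} → EdgeOn a b (b ∷ a ∷ xs)
  there : ∀ {x xs} → EdgeOn a b xs → EdgeOn a b (x ∷ xs)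

record Wiring (f : ℕ → ℕ) {w h s : ℕ} (Γ : Subgraph w h s) : Set where
  open Subgraph Γ
  field
    g       : Fin nv → YV
    g-ok    : ∀ a → InY f (g a)
    P       : Fin ne → List YV
    P-ok    : ∀ e → IsPath (YAdj f) (g (src e)) (g (tgt e)) (P e)

CoarseWiring : (f : ℕ → ℕ) {w h s : ℕ} {Γ : Subgraph w h s} → ℕ → Wiring f Γ → Set
CoarseWiring f {Γ = Γ} k W =
  (∀ (y : YV) (as : List (Fin (Subgraph.nv Γ))) →
     Unique as → All (λ a → Wiring.g W a ≡ y) as → length as ≤ k)
  × (∀ (y y' : YV) → YAdj f y y' → (es : List (Fin (Subgraph.ne Γ))) →
     Unique es → All (λ e → EdgeOn y y' (Wiring.P W e)) es → length es ≤ k)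

VolumeAtMost : (f : ℕ → ℕ) {w h s : ℕ} {Γ : Subgraph w h s} → Wiring f Γ → ℕ → Set
VolumeAtMost f {Γ = Γ} W N =
  Σ (List YV) λ L → Unique L × length L ≤ N
    × (∀ a → Wiring.g W a ∈ L)
    × (∀ e y → y ∈ Wiring.P W e → y ∈ L)

-- Stretch X_n vertically by s = xS n.  Since yS n = s², the vertex (i , j) of X_n can be
-- sent to (i , j s) in Y_n: a vertical edge becomes a vertical segment of s edges, and a
-- rung at a height j divisible by s lands at height j s, divisible by s², i.e. on a rung
-- of Y_n.  These images are pairwise edge-disjoint, and all of them lie in the single
-- component Y_n, whose size is the volume bound.
module Submission where

open import Defs
open import Data.Nat using (ℕ; zero; suc; _+_; _*_; _∸_; _^_; _≤_; _<_; z≤n; s≤s; s≤s⁻¹; z<s; NonZero; _⊓_; _⊔_; pred)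
open import Data.Nat.Properties
open import Data.Nat.DivMod using (_/_; _%_; +-distrib-/; m<n⇒m/n≡0; m*n/n≡m; m<n⇒m%n≡m; m*n%n≡0)
open import Data.Nat.Divisibility using (_∣_; *-monoˡ-∣)
open import Data.Nat.Tactic.RingSolver using (solve-∀)
open import Data.Fin using (Fin)
open import Data.Product using (_×_; _,_; Σ; ∃; proj₁; proj₂; uncurry)
open import Data.Sum using (_⊎_; inj₁; inj₂; swap)
open import Data.Empty using (⊥-elim)
open import Function using (_∘_)
open import Data.List using (List; []; _∷_; _++_; length; map; cartesianProduct; upTo; applyUpTo)
open import Data.List.Properties using (length-++; length-map; length-upTo)
open import Data.List.Relation.Unary.All as All using (All; []; _∷_)
open import Data.List.Relation.Unary.AllPairs using ([]; _∷_)
open import Data.List.Relation.Unary.Unique.Propositional using (Unique)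
open import Data.List.Relation.Unary.Unique.Propositional.Properties using (map⁺; cartesianProduct⁺; upTo⁺; applyUpTo⁺₁)
open import Data.List.Membership.Propositional using (_∈_)
open import Data.List.Membership.Propositional.Properties using (∈-map⁺; ∈-cartesianProduct⁺; ∈-upTo⁺)
open import Relation.Binary.PropositionalEquality

subsingleton-length≤1 : {A : Set} {Q : A → Set} → (∀ a b → Q a → Q b → a ≡ b) →
                        ∀ {as} → Unique as → All Q as → length as ≤ 1
subsingleton-length≤1 _ [] [] = z≤n
subsingleton-length≤1 _ (_ ∷ []) (_ ∷ []) = s≤s z≤n
subsingleton-length≤1 Q-unique ((a≢b ∷ _) ∷ _) (qa ∷ qb ∷ _) = ⊥-elim (a≢b (Q-unique _ _ qa qb))

length-cartesianProduct : {A B : Set} (xs : List A) (ys : List B) →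
                          length (cartesianProduct xs ys) ≡ length xs * length ys
length-cartesianProduct [] ys = refl
length-cartesianProduct (x ∷ xs) ys = begin
  length (map (x ,_) ys ++ cartesianProduct xs ys)  ≡⟨ length-++ (map (x ,_) ys) ⟩
  length (map (x ,_) ys) + length (cartesianProduct xs ys)
    ≡⟨ cong₂ _+_ (length-map (x ,_) ys) (length-cartesianProduct xs ys) ⟩
  length ys + length xs * length ys  ∎
  where open ≡-Reasoning

module _ {A : Set} {R : A → A → Set} where

  applyUpTo-chain : (x : ℕ → A) → ∀ k → (∀ c → c < k → R (x c) (x (suc c))) →
                    Chain R (x 0) (applyUpTo (x ∘ suc) k) (x k)
  applyUpTo-chain x zero _ = done
  applyUpTo-chain x (suc k) link =
    step (link 0 (s≤s z≤n)) (applyUpTo-chain (x ∘ suc) k (λ c c<k → link (suc c) (s≤s c<k)))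

  applyUpTo-isPath : (x : ℕ → A) → ∀ k → (∀ c → c < k → R (x c) (x (suc c))) →
                     (∀ {c c'} → c ≤ k → c' ≤ k → x c ≡ x c' → c ≡ c') →
                     IsPath R (x 0) (x k) (applyUpTo x (suc k))
  applyUpTo-isPath x k link x-injective = path (applyUpTo-chain x k link)
    (applyUpTo⁺₁ x (suc k) λ c<c' c'≤k eq →
      <⇒≢ c<c' (x-injective (≤-trans (<⇒≤ c<c') (s≤s⁻¹ c'≤k)) (s≤s⁻¹ c'≤k) eq))

module _ {A : Set} where

  applyUpTo-edgeOn : ∀ {y y'} (x : ℕ → A) k → EdgeOn y y' (applyUpTo x (suc k)) →
                     ∃ λ c → c < k × EdgeOn y y' (x c ∷ x (suc c) ∷ [])
  applyUpTo-edgeOn x zero (there ())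
  applyUpTo-edgeOn x (suc k) here = 0 , s≤s z≤n , here
  applyUpTo-edgeOn x (suc k) here' = 0 , s≤s z≤n , here'
  applyUpTo-edgeOn x (suc k) (there e) with applyUpTo-edgeOn (x ∘ suc) k e
  ... | c , c<k , e' = suc c , s≤s c<k , e'

⌈_/_⌉ : ℕ → (d : ℕ) → .{{NonZero d}} → ℕ
⌈ m / d ⌉ = (m + pred d) / d

[t+j*d]/d≡j : ∀ {t d} j .{{_ : NonZero d}} → t < d → (t + j * d) / d ≡ j
[t+j*d]/d≡j {t} {d} j t<d = begin
  (t + j * d) / d      ≡⟨ +-distrib-/ t (j * d) remainders<d ⟩
  t / d + j * d / d    ≡⟨ cong₂ _+_ (m<n⇒m/n≡0 t<d) (m*n/n≡m j d) ⟩
  j                    ∎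
  where
  open ≡-Reasoning
  remainders<d : t % d + j * d % d < d
  remainders<d = subst (_< d) (sym (trans (cong₂ _+_ (m<n⇒m%n≡m t<d) (m*n%n≡0 j d)) (+-identityʳ t))) t<d

⌈j*d/d⌉≡j : ∀ j d .{{_ : NonZero d}} → ⌈ j * d / d ⌉ ≡ j
⌈j*d/d⌉≡j j (suc p) = trans (cong (_/ suc p) (+-comm (j * suc p) p)) ([t+j*d]/d≡j j ≤-refl)

⌈[1+t+j*d]/d⌉≡1+j : ∀ {t d} j .{{_ : NonZero d}} → t < d → ⌈ suc t + j * d / d ⌉ ≡ suc j
⌈[1+t+j*d]/d⌉≡1+j {t} {suc p} j t<d =
  trans (cong (_/ suc p) (rearrange t j p)) ([t+j*d]/d≡j (suc j) t<d)
  where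
  rearrange : ∀ t j p → suc t + j * suc p + p ≡ t + suc j * suc p
  rearrange = solve-∀

yS≡xS*xS : ∀ n → yS n ≡ xS n * xS n
yS≡xS*xS n = begin
  2 ^ (2 ^ (2 * n + 1))        ≡⟨ cong (2 ^_) (^-distribˡ-+-* 2 (2 * n) 1) ⟩
  2 ^ (e * 2)                  ≡⟨ cong (2 ^_) (trans (*-comm e 2) (cong (e +_) (+-identityʳ e))) ⟩
  2 ^ (e + e)                  ≡⟨ ^-distribˡ-+-* 2 e e ⟩
  xS n * xS n                  ∎
  where
  open ≡-Reasoning
  e = 2 ^ (2 * n)

LAdj-LVertʳ : ∀ {w h s p q} → LAdj w h s p q → LVert w h q
LAdj-LVertʳ (inj₁ (vstep i<w 1+j≤h)) = i<w , 1+j≤h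
LAdj-LVertʳ (inj₁ (hstep 1+i<w j≤h _)) = 1+i<w , j≤h
LAdj-LVertʳ (inj₂ (vstep i<w 1+j≤h)) = i<w , <⇒≤ 1+j≤h
LAdj-LVertʳ (inj₂ (hstep 1+i<w j≤h _)) = <⇒≤ 1+i<w , j≤h

module _ {f : ℕ → ℕ} where

  YAdj-InYʳ : ∀ {y y'} → YAdj f y y' → InY f y'
  YAdj-InYʳ (refl , 1≤m , adj) = 1≤m , LAdj-LVertʳ adj

  YAdj-sym : ∀ {y y'} → YAdj f y y' → YAdj f y' y
  YAdj-sym (refl , 1≤m , adj) = refl , 1≤m , swap adj

  chain-InY-component : ∀ {y xs z} → Chain (YAdj f) y xs z →
                        All (λ y' → proj₁ y' ≡ proj₁ y × InY f y') xs
  chain-InY-component done = []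
  chain-InY-component (step adj@(refl , _) c) = (refl , YAdj-InYʳ adj) ∷ chain-InY-component c

  isPath-InY-component : ∀ {a b xs} → InY f a → IsPath (YAdj f) a b xs →
                         All (λ y → proj₁ y ≡ proj₁ a × InY f y) xs
  isPath-InY-component a∈Y (path c _) = (refl , a∈Y) ∷ chain-InY-component c

module _ (f : ℕ → ℕ) where

  component : ℕ → List YV
  component m = map (m ,_) (cartesianProduct (upTo (f m)) (upTo (suc (yS m * f m))))

  component-unique : ∀ m → Unique (component m)
  component-unique m = map⁺ (cong proj₂) (cartesianProduct⁺ (upTo⁺ (f m)) (upTo⁺ (suc (yS m * f m))))

  length-component : ∀ m → length (component m) ≡ (yS m * f m + 1) * f m
  length-component m = begin
    length (component m)                 ≡⟨ length-map (m ,_) (cartesianProduct (upTo w) (upTo (suc h))) ⟩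
    length (cartesianProduct (upTo w) (upTo (suc h)))
                                         ≡⟨ length-cartesianProduct (upTo w) (upTo (suc h)) ⟩
    length (upTo w) * length (upTo (suc h))
                                         ≡⟨ cong₂ _*_ (length-upTo w) (length-upTo (suc h)) ⟩
    w * suc h                            ≡⟨ *-comm w (suc h) ⟩
    suc h * w                            ≡⟨ cong (_* w) (+-comm 1 h) ⟩
    (h + 1) * w                          ∎
    where
    open ≡-Reasoning
    w = f m
    h = yS m * f m

  ∈-component : ∀ {m y} → proj₁ y ≡ m → InY f y → y ∈ component m
  ∈-component refl (_ , i<w , j≤h) = ∈-map⁺ _ (∈-cartesianProduct⁺ (∈-upTo⁺ i<w) (∈-upTo⁺ (s≤s j≤h)))

module _ {w h s} (Γ : Subgraph w h s) where
  open Subgraph Γ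

  Endpoints : Fin ne → Pt × Pt → Set
  Endpoints e q = q ≡ (vert (src e) , vert (tgt e)) ⊎ q ≡ (vert (tgt e) , vert (src e))

  endpoints-injective : ∀ {q} e e' → Endpoints e q → Endpoints e' q → e ≡ e'
  endpoints-injective e e' (inj₁ refl) (inj₁ eq) =
    edge-inj e e' (inj₁ (vert-inj _ _ (cong proj₁ eq) , vert-inj _ _ (cong proj₂ eq)))
  endpoints-injective e e' (inj₁ refl) (inj₂ eq) =
    edge-inj e e' (inj₂ (vert-inj _ _ (cong proj₁ eq) , vert-inj _ _ (cong proj₂ eq)))
  endpoints-injective e e' (inj₂ refl) (inj₁ eq) =
    edge-inj e e' (inj₂ (vert-inj _ _ (cong proj₂ eq) , vert-inj _ _ (cong proj₁ eq)))
  endpoints-injective e e' (inj₂ refl) (inj₂ eq) =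
    edge-inj e e' (inj₁ (vert-inj _ _ (cong proj₂ eq) , vert-inj _ _ (cong proj₁ eq)))

module Stretch (f : ℕ → ℕ) (n : ℕ) (1≤n : 1 ≤ n) where

  s : ℕ
  s = xS n

  instance
    s≢0 : NonZero s
    s≢0 = m^n≢0 2 (2 ^ (2 * n))

  stretch : Pt → YV
  stretch (i , j) = n , (i , j * s)

  stretch-injective : ∀ p q → stretch p ≡ stretch q → p ≡ q
  stretch-injective (i , j) (i' , j') eq =
    cong₂ _,_ (cong (proj₁ ∘ proj₂) eq) (*-cancelʳ-≡ j j' s (cong (proj₂ ∘ proj₂) eq))

  stretch-height : ∀ {j} → j ≤ s * f n → j * s ≤ yS n * f n
  stretch-height {j} j≤h = begin
    j * s            ≤⟨ *-monoˡ-≤ s j≤h ⟩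
    s * f n * s      ≡⟨ *-assoc s (f n) s ⟩
    s * (f n * s)    ≡⟨ cong (s *_) (*-comm (f n) s) ⟩
    s * (s * f n)    ≡⟨ *-assoc s s (f n) ⟨
    s * s * f n      ≡⟨ cong (_* f n) (yS≡xS*xS n) ⟨
    yS n * f n       ∎
    where open ≤-Reasoning

  stretch-InY : ∀ {p} → LVert (f n) (s * f n) p → InY f (stretch p)
  stretch-InY (i<w , j≤h) = 1≤n , i<w , stretch-height j≤h

  stretch-rung : ∀ {j} → s ∣ j → yS n ∣ j * s
  stretch-rung {j} s∣j = subst (_∣ j * s) (sym (yS≡xS*xS n)) (*-monoˡ-∣ s s∣j)

  rise fall : ℕ → ℕ → ℕ → YV
  rise i j c = n , (i , c + j * s)
  fall i j c = n , (i , (s ∸ c) + j * s)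

  fall≡rise : ∀ {i j c} → c < s → fall i j c ≡ rise i j (suc (s ∸ suc c))
  fall≡rise {i} {j} c<s = cong (rise i j) (+-∸-assoc 1 c<s)

  rise-step : ∀ {i j t} → i < f n → suc j ≤ s * f n → t < s → YAdj f (rise i j t) (rise i j (suc t))
  rise-step {i} {j} {t} i<w 1+j≤h t<s = refl , 1≤n , inj₁ (vstep i<w (begin
    suc t + j * s   ≤⟨ +-monoˡ-≤ (j * s) t<s ⟩
    suc j * s       ≤⟨ stretch-height 1+j≤h ⟩
    yS n * f n      ∎))
    where open ≤-Reasoning

  fall-step : ∀ {i j c} → i < f n → suc j ≤ s * f n → c < s → YAdj f (fall i j c) (fall i j (suc c))
  fall-step {i} {j} {c} i<w 1+j≤h c<s = subst (λ y → YAdj f y (fall i j (suc c))) (sym (fall≡rise {i} {j} c<s))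
    (YAdj-sym {f} (rise-step {i} {j} i<w 1+j≤h (∸-monoʳ-< z<s c<s)))

  rise-injective : ∀ {i j c c'} → rise i j c ≡ rise i j c' → c ≡ c'
  rise-injective {j = j} {c} {c'} eq = +-cancelʳ-≡ (j * s) c c' (cong (proj₂ ∘ proj₂) eq)

  fall-injective : ∀ {i j c c'} → c ≤ s → c' ≤ s → fall i j c ≡ fall i j c' → c ≡ c'
  fall-injective {j = j} {c} {c'} c≤s c'≤s eq =
    ∸-cancelˡ-≡ c≤s c'≤s (+-cancelʳ-≡ (j * s) (s ∸ c) (s ∸ c') (cong (proj₂ ∘ proj₂) eq))

  route : (u v : Pt) → LAdj (f n) (s * f n) s u v → List YV
  route (i , j) _ (inj₁ (vstep _ _)) = applyUpTo (rise i j) (suc s)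
  route _ (i , j) (inj₂ (vstep _ _)) = applyUpTo (fall i j) (suc s)
  route u v (inj₁ (hstep _ _ _)) = stretch u ∷ stretch v ∷ []
  route u v (inj₂ (hstep _ _ _)) = stretch u ∷ stretch v ∷ []

  route-isPath : ∀ u v adj → IsPath (YAdj f) (stretch u) (stretch v) (route u v adj)
  route-isPath (i , j) _ (inj₁ (vstep i<w 1+j≤h)) =
    applyUpTo-isPath (rise i j) s (λ _ → rise-step i<w 1+j≤h) (λ _ _ → rise-injective {i} {j})
  route-isPath _ (i , j) (inj₂ (vstep i<w 1+j≤h)) =
    subst (λ y → IsPath (YAdj f) (stretch (i , suc j)) y (applyUpTo (fall i j) (suc s)))
      (cong (λ t → n , (i , t + j * s)) (n∸n≡0 s))
      (applyUpTo-isPath (fall i j) s (λ _ → fall-step i<w 1+j≤h) (fall-injective {i} {j}))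
  route-isPath (i , j) _ (inj₁ (hstep 1+i<w j≤h s∣j)) =
    path (step (refl , 1≤n , inj₁ (hstep 1+i<w (stretch-height j≤h) (stretch-rung s∣j))) done)
      (((λ eq → 1+n≢n (sym (cong (proj₁ ∘ proj₂) eq))) ∷ []) ∷ [] ∷ [])
  route-isPath _ (i , j) (inj₂ (hstep 1+i<w j≤h s∣j)) =
    path (step (refl , 1≤n , inj₂ (hstep 1+i<w (stretch-height j≤h) (stretch-rung s∣j))) done)
      (((λ eq → 1+n≢n (cong (proj₁ ∘ proj₂) eq)) ∷ []) ∷ [] ∷ [])

  -- An edge of Y_n on a route is mapped back to the X_n edge it came from by rounding
  -- its heights down and up to multiples of s.
  carrier : YV → YV → Pt × Pt
  carrier (_ , (i , a)) (_ , (i' , b)) = (i ⊓ i' , (a ⊓ b) / s) , (i ⊔ i' , ⌈ a ⊔ b / s ⌉)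

  carrier-comm : ∀ y y' → carrier y y' ≡ carrier y' y
  carrier-comm (_ , (i , a)) (_ , (i' , b)) rewrite ⊓-comm i i' | ⊓-comm a b | ⊔-comm i i' | ⊔-comm a b = refl

  carrier-edgeOn-pair : ∀ {y y' a b} → EdgeOn y y' (a ∷ b ∷ []) → carrier y y' ≡ carrier a b
  carrier-edgeOn-pair here = refl
  carrier-edgeOn-pair {y} {y'} here' = carrier-comm y y'
  carrier-edgeOn-pair (there (there ()))

  carrier-rise : ∀ {i j t} → t < s → carrier (rise i j t) (rise i j (suc t)) ≡ ((i , j) , (i , suc j))
  carrier-rise {i} {j} {t} t<s
    rewrite ⊓-idem i | ⊔-idem i | m≤n⇒m⊓n≡m (n≤1+n (t + j * s)) | m≤n⇒m⊔n≡n (n≤1+n (t + j * s))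
          | [t+j*d]/d≡j j t<s | ⌈[1+t+j*d]/d⌉≡1+j j t<s = refl

  carrier-rung : ∀ i j → carrier (stretch (i , j)) (stretch (suc i , j)) ≡ ((i , j) , (suc i , j))
  carrier-rung i j
    rewrite ⊓-idem (j * s) | ⊔-idem (j * s) | m≤n⇒m⊓n≡m (n≤1+n i) | m≤n⇒m⊔n≡n (n≤1+n i)
          | m*n/n≡m j s {{s≢0}} | ⌈j*d/d⌉≡j j s {{s≢0}} = refl

  route-carrier : ∀ {y y'} u v adj → EdgeOn y y' (route u v adj) →
                  carrier y y' ≡ (u , v) ⊎ carrier y y' ≡ (v , u)
  route-carrier (i , j) _ (inj₁ (vstep _ _)) e with applyUpTo-edgeOn (rise i j) s e
  ... | c , c<s , e' = inj₁ (trans (carrier-edgeOn-pair e') (carrier-rise c<s))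
  route-carrier {y} {y'} _ (i , j) (inj₂ (vstep _ _)) e with applyUpTo-edgeOn (fall i j) s e
  ... | c , c<s , e' = inj₂ (begin
    carrier y y'                                         ≡⟨ carrier-edgeOn-pair e' ⟩
    carrier (fall i j c) (fall i j (suc c))              ≡⟨ carrier-comm (fall i j c) (rise i j t) ⟩
    carrier (rise i j t) (fall i j c)                    ≡⟨ cong (carrier (rise i j t)) (fall≡rise {i} {j} c<s) ⟩
    carrier (rise i j t) (rise i j (suc t))              ≡⟨ carrier-rise (∸-monoʳ-< z<s c<s) ⟩
    (i , j) , (i , suc j)                                ∎)
    where
    open ≡-Reasoning
    t = s ∸ suc c
  route-carrier (i , j) _ (inj₁ (hstep _ _ _)) e = inj₁ (trans (carrier-edgeOn-pair e) (carrier-rung i j))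
  route-carrier _ (i , j) (inj₂ (hstep _ _ _)) e =
    inj₂ (trans (carrier-edgeOn-pair e) (trans (carrier-comm (stretch (suc i , j)) (stretch (i , j))) (carrier-rung i j)))

  module _ (Γ : Subgraph (f n) (s * f n) s) where
    open Subgraph Γ

    stretchWiring : Wiring f Γ
    stretchWiring = record
      { g    = stretch ∘ vert
      ; g-ok = λ a → stretch-InY (vert-ok a)
      ; P    = λ e → route _ _ (edge-ok e)
      ; P-ok = λ e → route-isPath _ _ (edge-ok e)
      }

    stretchWiring-coarse : CoarseWiring f 1 stretchWiring
    stretchWiring-coarse =
      (λ _ _ → subsingleton-length≤1 λ a b ga≡y gb≡y →
        vert-inj a b (stretch-injective _ _ (trans ga≡y (sym gb≡y))))
      , (λ _ _ _ _ → subsingleton-length≤1 λ e e' on-e on-e' →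
        endpoints-injective Γ e e' (route-carrier _ _ (edge-ok e) on-e) (route-carrier _ _ (edge-ok e') on-e'))

    stretchWiring-volume : VolumeAtMost f stretchWiring ((yS n * f n + 1) * f n)
    stretchWiring-volume =
      component f n , component-unique f n , ≤-reflexive (length-component f n)
      , (λ a → ∈-component f refl (stretch-InY (vert-ok a)))
      , λ e _ y∈route → uncurry (∈-component f)
          (All.lookup (isPath-InY-component (stretch-InY (vert-ok (src e))) (route-isPath _ _ (edge-ok e))) y∈route)

mainTheorem3 : (f : ℕ → ℕ) → Surj f → f 1 ≡ 1
    → (∀ n → 2 ≤ n → 2 ≤ f n × f n ≤ n)
    → (∀ n → 2 ≤ n → InfinitePreimage f n)
    → ∀ n → 1 ≤ n
    → (Γ : Subgraph (f n) (xS n * f n) (xS n))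
    → Σ (Wiring f Γ) λ W → CoarseWiring f 1 W × VolumeAtMost f W ((yS n * f n + 1) * f n)
mainTheorem3 f _ _ _ _ n 1≤n Γ = stretchWiring Γ , stretchWiring-coarse Γ , stretchWiring-volume Γ
  where open Stretch f n 1≤n
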